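{- Let $pX$ be a process of a visibly pushdown automaton which provides unbounded popping. Then $pX$ is not regular with respect to trace equivalence, i.e. there is no state $F$ of a finite labelled transition system such that $pX$ and $F$ have the same set of traces.
   Context: A pushdown automaton over finite action set $\mathit{Act}$, stack alphabet $\Gamma$, control states $Q$ is a finite set of rules $pX\xrightarrow{a}q\alpha$ ($p,q\in Q$, $X\in\Gamma$, $\alpha\in\Gamma^*$), generating the labelled transition system on configurations $p\alpha\in Q\times\Gamma^*$ (top of stack leftmost) with $pX\gamma\xrightarrow{a}q\alpha\gamma$ for each rule and each $\gamma\in\Gamma^*$. It is a visibly pushdown automaton (vPDA) if $\mathit{Act}$ is partitioned into call, return, internal actions $\mathit{Act}_c,\mathit{Act}_r,\mathit{Act}_i$ and each rule $pX\xrightarrow{a}q\alpha$ has $|\alpha|=2,0,1$ for $a\in\mathit{Act}_c,\mathit{Act}_r,\mathit{Act}_i$ respectively. A process $pX$ is a configuration with one stack symbol. Define $h(a)=+1$ for $a\in\mathit{Act}_c$, $h(a)=-1$ for $a\in\mathit{Act}_r$, $h(a)=0$ for $a\in\mathit{Act}_i$, extended additively to words. $pX$ provides unbounded popping if for every natural number $d$ there exist a configuration $q\beta$ and a word $w\in\mathit{Act}^*$ with $h(w)\le -d$, $pX\to^* q\beta$, and $w$ executable from $q\beta$ (i.e. $q\beta\xrightarrow{w}s$ for some $s$). The set of traces of a state $s$ is $\{w\in\mathit{Act}^*\mid \exists s'.\ s\xrightarrow{w}s'\}$; two states are trace equivalent iff they have the same set of traces. A vPDA process is regular w.r.t. an equivalence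 $\equiv$ iff there is a state $F$ of a finite labelled transition system with $pX\equiv F$. -}

module Defs where

open import Data.Nat using (ℕ)
open import Data.Fin using (Fin)
open import Data.List using (List; []; _∷_; _++_; length; [_])
open import Data.List.Membership.Propositional using (_∈_)
open import Data.List.Relation.Unary.All using (All)
open import Data.Integer using (ℤ; +_; -_; _+_; _≤_)
open import Data.Product using (Σ; _×_; _,_; ∃)
open import Relation.Binary.PropositionalEquality using (_≡_)

data Kind : Set where
  call ret int : Kind

-- A pushdown automaton over Act = Fin nA, Γ = Fin nΓ, Q = Fin nQ:
-- a finite list of rules  p X --a--> q α
record Rule (nA nΓ nQ : ℕ) : Set where
  constructor rule
  field
    src  : Fin nQ
    top  : Fin nΓ
    act  : Fin nA
    tgt  : Fin nQ
    push : List (Fin nΓ)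

PDA : ℕ → ℕ → ℕ → Set
PDA nA nΓ nQ = List (Rule nA nΓ nQ)

arity : Kind → ℕ
arity call = 2
arity ret  = 0
arity int  = 1

IsVisibly : ∀ {nA nΓ nQ} → (Fin nA → Kind) → PDA nA nΓ nQ → Set
IsVisibly kind Δ = All (λ r → length (Rule.push r) ≡ arity (kind (Rule.act r))) Δ

Config : ℕ → ℕ → Set
Config nΓ nQ = Fin nQ × List (Fin nΓ)

data Step {nA nΓ nQ} (Δ : PDA nA nΓ nQ) : Config nΓ nQ → Fin nA → Config nΓ nQ → Set where
  step : ∀ {p X a q α} γ → rule p X a q α ∈ Δ →
         Step Δ (p , X ∷ γ) a (q , α ++ γ)

data Steps {S A : Set} (T : S → A → S → Set) : S → List A → S → Set where
  done : ∀ {s} → Steps T s [] s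
  more : ∀ {s a s' w s''} → T s a s' → Steps T s' w s'' → Steps T s (a ∷ w) s''

Reach : ∀ {S A : Set} → (S → A → S → Set) → S → S → Set
Reach {A = A} T s s' = Σ (List A) (λ w → Steps T s w s')

IsTrace : ∀ {S A : Set} → (S → A → S → Set) → S → List A → Set
IsTrace {S} T s w = Σ S (λ s' → Steps T s w s')

hAct : ∀ {nA} → (Fin nA → Kind) → Fin nA → ℤ
hAct kind a with kind a
... | call = + 1
... | ret  = - (+ 1)
... | int  = + 0

h : ∀ {nA} → (Fin nA → Kind) → List (Fin nA) → ℤ
h kind []      = + 0
h kind (a ∷ w) = hAct kind a + h kind w

UnboundedPopping : ∀ {nA nΓ nQ} → (Fin nA → Kind) → PDA nA nΓ nQ →
                   Fin nQ → Fin nΓ → Set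
UnboundedPopping kind Δ p X =
  (d : ℕ) → Σ (Config _ _) λ qβ → Σ (List (Fin _)) λ w →
    (h kind w ≤ - (+ d)) × Reach (Step Δ) (p , [ X ]) qβ × IsTrace (Step Δ) qβ w

TraceEquiv : ∀ {S₁ S₂ A : Set} → (S₁ → A → S₁ → Set) → S₁ →
             (S₂ → A → S₂ → Set) → S₂ → Set
TraceEquiv {A = A} T₁ s₁ T₂ s₂ =
  (w : List A) → (IsTrace T₁ s₁ w → IsTrace T₂ s₂ w) × (IsTrace T₂ s₂ w → IsTrace T₁ s₁ w)

TraceRegular : ∀ {nA nΓ nQ} → PDA nA nΓ nQ → Fin nQ → Fin nΓ → Set₁
TraceRegular {nA} Δ p X =
  Σ ℕ λ n → Σ (Fin n → Fin nA → Fin n → Set) λ T → Σ (Fin n) λ F →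
    TraceEquiv (Step Δ) (p , [ X ]) T F

-- In a visibly pushdown automaton every action changes the stack length by exactly its height h,
-- so every trace of a process pX has height at least -1. A finite LTS with n states that is trace
-- equivalent to pX would, by unbounded popping, run a word of height at most -(n+1). Among the
-- states where this run first reaches depths -1, -2, ..., -(n+1) two coincide; this gives a
-- reachable cycle of negative height, and pumping it yields traces of arbitrarily negative height.
module Submission where

open import Defs
open import Data.Nat as ℕ using (ℕ; zero; suc)
import Data.Nat.Properties as ℕ
open import Data.Fin using (Fin; _≟_)
import Data.Fin.Properties as Fin
open import Data.Integer as ℤ
  using (+_; -_; _+_; _≤_; 0ℤ; 1ℤ; -1ℤ; ∣_∣; +≤+; -≤-; -≤+; +<+)
import Data.Integer.Properties as ℤ
open import Data.Integer.Tactic.RingSolver using (solve-∀)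
open import Data.List using ([]; _∷_; _++_; length; [_])
open import Data.List.Properties using (length-++)
import Data.List.Relation.Unary.All as List
open import Data.Vec using (Vec; []; _∷_)
open import Data.Vec.Relation.Unary.All as All using (All; []; _∷_)
open import Data.Vec.Relation.Unary.Unique.Propositional using (Unique; []; _∷_)
open import Data.Vec.Relation.Unary.Unique.Propositional.Properties using (lookup-injective)
open import Data.Product using (∃; ∃₂; _×_; _,_; proj₁; proj₂)
open import Data.Sum using (_⊎_; inj₁; inj₂; swap)
open import Relation.Nullary.Decidable using (toSum)
open import Data.Empty using (⊥-elim)
open import Relation.Nullary using (¬_)
open import Relation.Binary.PropositionalEquality
  using (_≡_; refl; sym; cong; subst; module ≡-Reasoning)

module _ {S A : Set} {T : S → A → S → Set} where

  Steps-++⁺ : ∀ {s s' s'' x y} → Steps T s x s' → Steps T s' y s'' → Steps T s (x ++ y) s''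
  Steps-++⁺ done       r' = r'
  Steps-++⁺ (more t r) r' = more t (Steps-++⁺ r r')

  Steps-++⁻ : ∀ x {y s s''} → Steps T s (x ++ y) s'' →
              ∃ λ s' → Steps T s x s' × Steps T s' y s''
  Steps-++⁻ []      r          = _ , done , r
  Steps-++⁻ (a ∷ x) (more t r) with Steps-++⁻ x r
  ... | s' , r₁ , r₂ = s' , more t r₁ , r₂

  Reach-trans : ∀ {s s' s''} → Reach T s s' → Reach T s' s'' → Reach T s s''
  Reach-trans (x , r) (y , r') = x ++ y , Steps-++⁺ r r'

Unique⇒m≤n : ∀ {m n} {xs : Vec (Fin n) m} → Unique xs → m ℕ.≤ n
Unique⇒m≤n u = Fin.injective⇒≤ (λ {i} {j} → lookup-injective u i j)

-i+[i+j]≡j : ∀ i j → - i + (i + j) ≡ j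
-i+[i+j]≡j = solve-∀

i+[-i+j]≡j : ∀ i j → i + (- i + j) ≡ j
i+[-i+j]≡j = solve-∀

i≤+∣i∣ : ∀ i → i ≤ + ∣ i ∣
i≤+∣i∣ (+ n)      = ℤ.≤-refl
i≤+∣i∣ ℤ.-[1+ n ] = -≤+

module _ {nA : ℕ} (kind : Fin nA → Kind) where

  h-++ : ∀ x y → h kind (x ++ y) ≡ h kind x + h kind y
  h-++ []      y = sym (ℤ.+-identityˡ (h kind y))
  h-++ (a ∷ x) y rewrite h-++ x y = sym (ℤ.+-assoc (hAct kind a) (h kind x) (h kind y))

  -1≤hAct : ∀ a → -1ℤ ≤ hAct kind a
  -1≤hAct a with kind a
  ... | call = -≤+
  ... | ret  = ℤ.≤-refl
  ... | int  = -≤+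

  -- A discrete intermediate value theorem: heights of prefixes move down by at most one.
  split-at-height : ∀ w {k} → h kind w ≤ k → k ≤ 0ℤ →
                    ∃₂ λ x y → w ≡ x ++ y × h kind x ≡ k
  split-at-height w       {+ zero}     _    _          = [] , w , refl , refl
  split-at-height w       {+ suc _}    _    (+≤+ ())
  split-at-height []      {ℤ.-[1+ _ ]} ()   _
  split-at-height (a ∷ w) {k@(ℤ.-[1+ _ ])} hw≤k _
    with split-at-height w { - hAct kind a + k} hw≤k' k'≤0
    where
    hw≤k' : h kind w ≤ - hAct kind a + k
    hw≤k' = subst (_≤ - hAct kind a + k) (-i+[i+j]≡j (hAct kind a) (h kind w))
                  (ℤ.+-monoʳ-≤ (- hAct kind a) hw≤k)
    k'≤0 : - hAct kind a + k ≤ 0ℤ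
    k'≤0 = ℤ.+-mono-≤ (ℤ.neg-mono-≤ (-1≤hAct a)) (-≤- ℕ.z≤n)
  ... | x , y , refl , hx = a ∷ x , y , refl , hax
    where
    hax : hAct kind a + h kind x ≡ k
    hax rewrite hx = i+[-i+j]≡j (hAct kind a) k

  split-run-at-unit-descent : ∀ {S} {T : S → Fin nA → S → Set} {s s'' w} k →
    Steps T s w s'' → h kind w ≤ - + suc k →
    ∃₂ λ x y → ∃ λ s' → Steps T s x s' × h kind x ≡ -1ℤ × Steps T s' y s'' × h kind y ≤ - + k
  split-run-at-unit-descent {w = w} k run hw≤-1-k
    with split-at-height w (ℤ.≤-trans hw≤-1-k (-≤- ℕ.z≤n)) -≤+
  ... | x , y , refl , hx≡-1 with Steps-++⁻ x run
  ... | s' , s-x-s' , s'-y-s'' = x , y , s' , s-x-s' , hx≡-1 , s'-y-s'' , (begin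
    h kind y                   ≡⟨ -i+[i+j]≡j -1ℤ (h kind y) ⟨
    1ℤ + (-1ℤ + h kind y)      ≡⟨ cong (λ i → 1ℤ + (i + h kind y)) hx≡-1 ⟨
    1ℤ + (h kind x + h kind y) ≡⟨ cong (λ i → 1ℤ + i) (h-++ x y) ⟨
    1ℤ + h kind (x ++ y)       ≤⟨ ℤ.+-monoʳ-≤ 1ℤ hw≤-1-k ⟩
    1ℤ + - + suc k             ≡⟨ ℤ.1-[1+n]≡-n k ⟩
    - + k                      ∎)
    where open ℤ.≤-Reasoning

module _ {nA nΓ nQ : ℕ} {kind : Fin nA → Kind} {Δ : PDA nA nΓ nQ} (visibly : IsVisibly kind Δ) where

  arity+n≡1+n+hAct : ∀ a n → + (arity (kind a) ℕ.+ n) ≡ + suc n + hAct kind a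
  arity+n≡1+n+hAct a n with kind a
  ... | call = cong (λ m → + suc m) (ℕ.+-comm 1 n)
  ... | ret  = refl
  ... | int  = cong +_ (sym (ℕ.+-identityʳ (suc n)))

  stack-length-Step : ∀ {c a c'} → Step Δ c a c' →
                      + length (proj₂ c') ≡ + length (proj₂ c) + hAct kind a
  stack-length-Step (step {a = a} {α = α} γ r∈Δ)
    rewrite length-++ α {γ} | List.lookup visibly r∈Δ = arity+n≡1+n+hAct a (length γ)

  stack-length-Steps : ∀ {c w c'} → Steps (Step Δ) c w c' →
                       + length (proj₂ c') ≡ + length (proj₂ c) + h kind w
  stack-length-Steps {c} done = sym (ℤ.+-identityʳ (+ length (proj₂ c)))
  stack-length-Steps {c} (more {a = a} {s' = c₁} {w = w} {s'' = c₂} t r) = begin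
    + length (proj₂ c₂)                           ≡⟨ stack-length-Steps r ⟩
    + length (proj₂ c₁) + h kind w                ≡⟨ cong (_+ h kind w) (stack-length-Step t) ⟩
    + length (proj₂ c) + hAct kind a + h kind w   ≡⟨ ℤ.+-assoc (+ length (proj₂ c)) (hAct kind a) (h kind w) ⟩
    + length (proj₂ c) + (hAct kind a + h kind w) ∎
    where open ≡-Reasoning

  -- The stack of a process starts with one symbol and never has negative length.
  process-trace-height : ∀ {p X w} → IsTrace (Step Δ) (p , [ X ]) w → -1ℤ ≤ h kind w
  process-trace-height {w = w} (c' , r) = begin
    -1ℤ                        ≤⟨ ℤ.+-monoʳ-≤ -1ℤ (+≤+ (ℕ.z≤n {length (proj₂ c')})) ⟩
    -1ℤ + + length (proj₂ c')  ≡⟨ cong (λ i → -1ℤ + i) (stack-length-Steps r) ⟩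
    -1ℤ + (1ℤ + h kind w)      ≡⟨ -i+[i+j]≡j 1ℤ (h kind w) ⟩
    h kind w                   ∎
    where open ℤ.≤-Reasoning

module _ {nA n : ℕ} (kind : Fin nA → Kind) (T : Fin n → Fin nA → Fin n → Set) where

  Descent : Fin n → Fin n → Set
  Descent g f = ∃ λ y → Steps T g y f × h kind y ≤ -1ℤ

  ReachableDescentCycle : Fin n → Set
  ReachableDescentCycle f = ∃ λ g → Reach T f g × Descent g g

  Descent-trans : ∀ {e f g} → Descent e f → Descent f g → Descent e g
  Descent-trans (y , e-y-f , hy≤-1) (z , f-z-g , hz≤-1) = y ++ z , Steps-++⁺ e-y-f f-z-g , (begin
    h kind (y ++ z)     ≡⟨ h-++ kind y z ⟩
    h kind y + h kind z ≤⟨ ℤ.+-mono-≤ hy≤-1 hz≤-1 ⟩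
    -1ℤ + -1ℤ           ≤⟨ -≤- ℕ.z≤n ⟩
    -1ℤ                 ∎)
    where open ℤ.≤-Reasoning

  -- Pigeonhole: L lists distinct states from which the current state g is reached by a descent;
  -- each further unit of depth below g adds g to L unless g already closes a cycle.
  descent-cycle-or-shallow : ∀ {m g w s} k (L : Vec (Fin n) m) → Unique L →
    All (λ e → Descent e g) L → Steps T g w s → h kind w ≤ - + k →
    ReachableDescentCycle g ⊎ m ℕ.+ k ℕ.≤ n
  descent-cycle-or-shallow {m} zero L unique _ _ _ =
    inj₂ (subst (ℕ._≤ _) (sym (ℕ.+-identityʳ m)) (Unique⇒m≤n unique))
  descent-cycle-or-shallow {m} {g} (suc k) L unique descents run hw≤-1-k
    with split-run-at-unit-descent kind k run hw≤-1-k
  ... | x , y , g' , g-x-g' , hx≡-1 , g'-y-s , hy≤-k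
    with All.decide (λ e → swap (toSum (g ≟ e))) L
  ... | inj₂ g∈L = inj₁ (g , ([] , done) , All.lookup descents g∈L)
  ... | inj₁ g∉L
    with descent-cycle-or-shallow k (g ∷ L) (g∉L ∷ unique)
           (g⇝g' ∷ All.map (λ d → Descent-trans d g⇝g') descents) g'-y-s hy≤-k
    where
    g⇝g' : Descent g g'
    g⇝g' = x , g-x-g' , ℤ.≤-reflexive hx≡-1
  ... | inj₁ (c , g'⇝c , cycle) = inj₁ (c , Reach-trans (x , g-x-g') g'⇝c , cycle)
  ... | inj₂ 1+m+k≤n            = inj₂ (subst (ℕ._≤ n) (sym (ℕ.+-suc m k)) 1+m+k≤n)

  deep-run⇒descent-cycle : ∀ {f w s} → Steps T f w s → h kind w ≤ - + suc n →
                           ReachableDescentCycle f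
  deep-run⇒descent-cycle run hw≤-1-n with descent-cycle-or-shallow (suc n) [] [] [] run hw≤-1-n
  ... | inj₁ cycle = cycle
  ... | inj₂ 1+n≤n = ⊥-elim (ℕ.1+n≰n 1+n≤n)

  -- Going once more around the cycle lowers the height by at least one, forever.
  bounded-traces⇒¬descent-cycle : ∀ {F} → (∀ {z} → IsTrace T F z → -1ℤ ≤ h kind z) →
                                   ¬ ReachableDescentCycle F
  bounded-traces⇒¬descent-cycle {F} bounded (g , (x , F-x-g) , (y , g-y-g , hy≤-1))
    with pumped (suc (suc ∣ h kind x ∣))
    where
    pumped : ∀ t → ∃ λ z → Steps T F z g × h kind z + + t ≤ h kind x
    pumped zero    = x , F-x-g , ℤ.≤-reflexive (ℤ.+-identityʳ (h kind x))
    pumped (suc t) with pumped t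
    ... | z , F-z-g , hz+t≤hx = z ++ y , Steps-++⁺ F-z-g g-y-g , (begin
      h kind (z ++ y) + (1ℤ + + t)     ≡⟨ cong (_+ (1ℤ + + t)) (h-++ kind z y) ⟩
      h kind z + h kind y + (1ℤ + + t) ≡⟨ shuffle (h kind z) (h kind y) (+ t) ⟩
      h kind z + + t + (h kind y + 1ℤ) ≤⟨ ℤ.+-monoʳ-≤ (h kind z + + t) (ℤ.+-monoˡ-≤ 1ℤ hy≤-1) ⟩
      h kind z + + t + 0ℤ              ≡⟨ ℤ.+-identityʳ (h kind z + + t) ⟩
      h kind z + + t                   ≤⟨ hz+t≤hx ⟩
      h kind x                         ∎)
      where
      open ℤ.≤-Reasoning
      shuffle : ∀ a b c → a + b + (1ℤ + c) ≡ a + c + (b + 1ℤ)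
      shuffle = solve-∀
  ... | z , F-z-g , hz+t≤hx = ℤ.<-irrefl refl (begin-strict
    + suc ∣ h kind x ∣                  ≡⟨⟩
    -1ℤ + + suc (suc ∣ h kind x ∣)      ≤⟨ ℤ.+-monoˡ-≤ (+ suc (suc ∣ h kind x ∣)) (bounded (_ , F-z-g)) ⟩
    h kind z + + suc (suc ∣ h kind x ∣) ≤⟨ hz+t≤hx ⟩
    h kind x                            ≤⟨ i≤+∣i∣ (h kind x) ⟩
    + ∣ h kind x ∣                      <⟨ +<+ (ℕ.n<1+n ∣ h kind x ∣) ⟩
    + suc ∣ h kind x ∣                  ∎)
    where open ℤ.≤-Reasoning

lemma4p3 : {nA nΓ nQ : ℕ} (kind : Fin nA → Kind) (Δ : PDA nA nΓ nQ) →
    IsVisibly kind Δ → (p : Fin nQ) (X : Fin nΓ) →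
    UnboundedPopping kind Δ p X → ¬ TraceRegular Δ p X
lemma4p3 kind Δ visibly p X popping (n , T , F , pX≈F)
  with popping (suc n)
... | _ , w , hw≤-1-n , (v , pX-v-qβ) , (s , qβ-w-s)
  with proj₁ (pX≈F (v ++ w)) (s , Steps-++⁺ pX-v-qβ qβ-w-s)
... | _ , F-vw-s'
  with Steps-++⁻ v F-vw-s'
... | f , F-v-f , f-w-s' =
  bounded-traces⇒¬descent-cycle kind T F-traces-bounded
    (let g , f⇝g , cycle = deep-run⇒descent-cycle kind T f-w-s' hw≤-1-n
     in g , Reach-trans (v , F-v-f) f⇝g , cycle)
  where
  F-traces-bounded : ∀ {z} → IsTrace T F z → -1ℤ ≤ h kind z
  F-traces-bounded F-z = process-trace-height visibly (proj₂ (pX≈F _) F-z)
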